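{- Let $q$ be a rational number. (i) For $q_2=q^2-2=C_2(q)$ we have $\Pi_0(q_2)=\Pi_0(q)\cup\Pi_1(q)$ and $\Pi_k(q_2)=\Pi_{k+1}(q)$ for $k=1,2,\dots$. (ii) If $q_n=C_n(q)$ for an odd $n\ge1$, then $\Pi_j(q_n)=\Pi_j(q)$ for all $j=0,1,2,\dots$. (iii) $\Pi_i(-q)=\Pi_{1-i}(q)$ for $i=0,1$, and $\Pi_j(-q)=\Pi_j(q)$ for $j=2,3,\dots$.
   Context: Chebyshev polynomials: $U_n\in\mathbb Z[q]$ are defined by $U_0=0$, $U_1=1$, $U_{n+1}=qU_n-U_{n-1}$; $C_n=U_{n+1}-U_{n-1}$ (so $C_0=2$, $C_1=q$, $C_{n+1}=qC_n-C_{n-1}$); for odd $n=2k+1$, $V_n=U_{k+1}-U_k$ and $W_n=U_{k+1}+U_k$. For a rational $q=a/b$ in lowest terms and a prime $p\nmid b$, congruences mod $p$ of rationals with denominators prime to $p$ are understood in $\mathbb F_p$. $\mathcal D(q)$ is the set of prime divisors of $b$; $\Pi$ is the set of odd primes. For $p\in\Pi\setminus\mathcal D(q)$: $p\in\Pi_0(q)$ if $W_n(q)\equiv0\bmod p$ for some odd $n\ge1$; $p\in\Pi_1(q)$ if $V_n(q)\equiv0\bmod p$ for some odd $n\ge1$; $p\in\Pi_{2+k}(q)$ ($k\ge0$) if $C_{2^kn}(q)\equiv0\bmod p$ for some odd $n\ge1$. -}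

module Defs where

open import Data.Nat using (ℕ; zero; suc; _*_; _^_)
open import Data.Nat.Divisibility using (_∣_)
open import Data.Nat.Primality using (Prime)
open import Data.Integer using (∣_∣)
open import Data.Rational using (ℚ; ↥_; ↧ₙ_; 0ℚ; 1ℚ; _+_; _-_) renaming (_*_ to _*ℚ_)
open import Data.Product using (Σ; _×_)
open import Relation.Nullary using (¬_)

U : ℕ → ℚ → ℚ
U zero q = 0ℚ
U (suc zero) q = 1ℚ
U (suc (suc n)) q = q *ℚ U (suc n) q - U n q

-- C_n = U_{n+1} - U_{n-1}, equivalently C_0 = 2, C_1 = q, C_{n+1} = q C_n - C_{n-1}.
C : ℕ → ℚ → ℚ
C zero q = 1ℚ + 1ℚ
C (suc n) q = U (suc (suc n)) q - U n q

-- For odd n = 2k+1:  V_n = U_{k+1} - U_k,  W_n = U_{k+1} + U_k  (indexed by k).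
V : ℕ → ℚ → ℚ
V k q = U (suc k) q - U k q

W : ℕ → ℚ → ℚ
W k q = U (suc k) q + U k q

-- x ≡ 0 mod p for a rational x whose (reduced) denominator is prime to p:
-- p divides the numerator of x in lowest terms.
ZeroMod : ℕ → ℚ → Set
ZeroMod p x = p ∣ ∣ ↥ x ∣

Admissible : ℚ → ℕ → Set
Admissible q p = Prime p × ¬ (2 ∣ p) × ¬ (p ∣ ↧ₙ q)

Pi : ℕ → ℚ → ℕ → Set
Pi zero q p = Admissible q p × Σ ℕ (λ k → ZeroMod p (W k q))
Pi (suc zero) q p = Admissible q p × Σ ℕ (λ k → ZeroMod p (V k q))
Pi (suc (suc k)) q p = Admissible q p × Σ ℕ (λ m → ZeroMod p (C (2 ^ k * suc (2 * m)) q))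

{-# OPTIONS --safe #-}
module Submission where

open import Defs
open import Data.Nat as ℕ using (ℕ; zero; suc)
import Data.Nat.Properties as ℕ
open import Data.Nat.Primality using (Prime)
open import Data.Nat.Tactic.RingSolver using () renaming (solve-∀ to ℕ-solve-∀)
open import Data.Product using (Σ; _×_; _,_; proj₁; proj₂)
open import Function.Bundles using (_⇔_; mk⇔; Equivalence)
open import Relation.Binary.PropositionalEquality

-- Reduction modulo p.  A rational q whose denominator is prime to p is congruent to an integer t, which
-- turns each Πⱼ into a statement about integer Chebyshev values at t.  Conversely, if p divides the
-- denominator of q then r = 1/q ≡ 0, and Sₙ = rⁿ Cₙ(q) satisfies Sₙ₊₂ = (qr) Sₙ₊₁ − r² Sₙ, so Sₙ₊₁ ≡ 1;
-- hence p divides the denominator of every Cₙ₊₁(q), and admissibility transfers in both directions.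
--
-- Over ℤ, C₂ₖ₊₁ − 2 = (t − 2) Wₖ² and C₂ₖ₊₁ + 2 = (t + 2) Vₖ², so p ∈ Π₀ (resp. Π₁) iff Cₙ(t) ≡ 2
-- (resp. −2) for some odd n; when p ∣ t ∓ 2 one takes k = (p − 1)/2, as Wₖ(2) = p and Vₖ(−2) = ±Wₖ(2).
-- The rest is the composition law Cₘ ∘ Cₙ = Cₘₙ: since C₂(x) = x² − 2, the condition Cₙ ≡ 2 at C₂(t)
-- splits into Cₙ(t) ≡ ±2 and Cₙ ≡ −2 at C₂(t) becomes Cₙ(t) ≡ 0; for odd n, Cₙ fixes 2, −2 and 0 and
-- preserves odd indices; and t ↦ −t only changes Cₙ, Vₖ, Wₖ by signs, exchanging V and W.

module Chebyshevℤ where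

  open import Data.Integer using (ℤ; +_; -1ℤ; _+_; _*_; _-_; -_; _^_)
  import Data.Integer.Properties as ℤ
  open import Data.Integer.Divisibility.Signed using (_∣_; divides; ∣m∣n⇒∣m+n; ∣m∣n⇒∣m-n; ∣n⇒∣m*n; ∣m⇒∣m*n; ∣-refl; ∣-trans)
  open import Data.Integer.Tactic.RingSolver using (solve-∀)
  open ≡-Reasoning

  Uℤ : ℕ → ℤ → ℤ
  Uℤ zero z = + 0
  Uℤ (suc zero) z = + 1
  Uℤ (suc (suc n)) z = z * Uℤ (suc n) z - Uℤ n z

  Cℤ : ℕ → ℤ → ℤ
  Cℤ zero z = + 2
  Cℤ (suc n) z = Uℤ (suc (suc n)) z - Uℤ n z

  Vℤ : ℕ → ℤ → ℤ
  Vℤ k z = Uℤ (suc k) z - Uℤ k z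

  Wℤ : ℕ → ℤ → ℤ
  Wℤ k z = Uℤ (suc k) z + Uℤ k z

  Cℤ-1 : ∀ z → Cℤ 1 z ≡ z
  Cℤ-1 = unfolded
    where
    unfolded : ∀ z → (z * + 1 - + 0) - + 0 ≡ z
    unfolded = solve-∀

  Cℤ-2 : ∀ z → Cℤ 2 z ≡ z * z - + 2
  Cℤ-2 = unfolded
    where
    unfolded : ∀ z → (z * (z * + 1 - + 0) - + 1) - + 1 ≡ z * z - + 2
    unfolded = solve-∀

  Cℤ-recurrence : ∀ n z → Cℤ (suc (suc n)) z ≡ z * Cℤ (suc n) z - Cℤ n z
  Cℤ-recurrence zero z = base z
    where
    base : ∀ z → (z * (z * + 1 - + 0) - + 1) - + 1 ≡ z * ((z * + 1 - + 0) - + 0) - + 2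
    base = solve-∀
  Cℤ-recurrence (suc n) z = regroup z (Uℤ (3 ℕ.+ n) z) (Uℤ (2 ℕ.+ n) z) (Uℤ (suc n) z) (Uℤ n z)
    where
    regroup : ∀ z a b c d → (z * a - b) - (z * c - d) ≡ z * (a - c) - (b - d)
    regroup = solve-∀

  Cℤ-at : ∀ {m n} z → m ≡ n → Cℤ m z ≡ Cℤ n z
  Cℤ-at z = cong (λ i → Cℤ i z)

  Cℤ-product : ∀ k a z → Cℤ (k ℕ.+ a) z * Cℤ k z ≡ Cℤ (k ℕ.+ (k ℕ.+ a)) z + Cℤ a z
  Cℤ-product zero a z = double (Cℤ a z)
    where
    double : ∀ x → x * + 2 ≡ x + x
    double = solve-∀
  Cℤ-product (suc zero) a z = begin
    Cℤ (suc a) z * Cℤ 1 z                ≡⟨ cong (Cℤ (suc a) z *_) (Cℤ-1 z) ⟩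
    Cℤ (suc a) z * z                     ≡⟨ shuffle z (Cℤ (suc a) z) (Cℤ a z) ⟩
    (z * Cℤ (suc a) z - Cℤ a z) + Cℤ a z ≡⟨ cong (_+ Cℤ a z) (Cℤ-recurrence a z) ⟨
    Cℤ (suc (suc a)) z + Cℤ a z          ∎
    where
    shuffle : ∀ z x y → x * z ≡ (z * x - y) + y
    shuffle = solve-∀
  Cℤ-product (suc (suc k)) a z =
    step (subst₂ (λ i j → Cℤ i z * Cℤ (suc k) z ≡ Cℤ j z + Cℤ (suc a) z) (index₁ k a) (index₂ k a)
            (Cℤ-product (suc k) (suc a) z))
         (subst₂ (λ i j → Cℤ i z * Cℤ k z ≡ Cℤ j z + Cℤ (2 ℕ.+ a) z) (index₃ k a) (index₄ k a)
            (Cℤ-product k (2 ℕ.+ a) z))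
    where
    s = k ℕ.+ (k ℕ.+ a)
    X = Cℤ (2 ℕ.+ k ℕ.+ a) z
    index₁ : ∀ k a → suc k ℕ.+ suc a ≡ 2 ℕ.+ k ℕ.+ a
    index₁ = ℕ-solve-∀
    index₂ : ∀ k a → suc k ℕ.+ (suc k ℕ.+ suc a) ≡ 3 ℕ.+ (k ℕ.+ (k ℕ.+ a))
    index₂ = ℕ-solve-∀
    index₃ : ∀ k a → k ℕ.+ (2 ℕ.+ a) ≡ 2 ℕ.+ k ℕ.+ a
    index₃ = ℕ-solve-∀
    index₄ : ∀ k a → k ℕ.+ (k ℕ.+ (2 ℕ.+ a)) ≡ 2 ℕ.+ (k ℕ.+ (k ℕ.+ a))
    index₄ = ℕ-solve-∀
    index₅ : ∀ k a → 4 ℕ.+ (k ℕ.+ (k ℕ.+ a)) ≡ 2 ℕ.+ k ℕ.+ (2 ℕ.+ k ℕ.+ a)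
    index₅ = ℕ-solve-∀
    distribute : ∀ z x c d → x * (z * c - d) ≡ z * (x * c) - x * d
    distribute = solve-∀
    collect : ∀ z c₃ c₂ c₁ c₀ → z * (c₃ + c₁) - (c₂ + (z * c₁ - c₀)) ≡ (z * c₃ - c₂) + c₀
    collect = solve-∀
    step : X * Cℤ (suc k) z ≡ Cℤ (3 ℕ.+ s) z + Cℤ (suc a) z
         → X * Cℤ k z ≡ Cℤ (2 ℕ.+ s) z + Cℤ (2 ℕ.+ a) z
         → X * Cℤ (2 ℕ.+ k) z ≡ Cℤ (2 ℕ.+ k ℕ.+ (2 ℕ.+ k ℕ.+ a)) z + Cℤ a z
    step ih₁ ih₂ = begin
      X * Cℤ (2 ℕ.+ k) z                                ≡⟨ cong (X *_) (Cℤ-recurrence k z) ⟩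
      X * (z * Cℤ (suc k) z - Cℤ k z)                   ≡⟨ distribute z X (Cℤ (suc k) z) (Cℤ k z) ⟩
      z * (X * Cℤ (suc k) z) - X * Cℤ k z               ≡⟨ cong₂ (λ s t → z * s - t) ih₁ ih₂ ⟩
      z * (Cℤ (3 ℕ.+ s) z + Cℤ (suc a) z) - (Cℤ (2 ℕ.+ s) z + Cℤ (2 ℕ.+ a) z)
        ≡⟨ cong (λ c → z * (Cℤ (3 ℕ.+ s) z + Cℤ (suc a) z) - (Cℤ (2 ℕ.+ s) z + c)) (Cℤ-recurrence a z) ⟩
      z * (Cℤ (3 ℕ.+ s) z + Cℤ (suc a) z) - (Cℤ (2 ℕ.+ s) z + (z * Cℤ (suc a) z - Cℤ a z))
        ≡⟨ collect z (Cℤ (3 ℕ.+ s) z) (Cℤ (2 ℕ.+ s) z) (Cℤ (suc a) z) (Cℤ a z) ⟩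
      (z * Cℤ (3 ℕ.+ s) z - Cℤ (2 ℕ.+ s) z) + Cℤ a z     ≡⟨ cong (_+ Cℤ a z) (Cℤ-recurrence (2 ℕ.+ s) z) ⟨
      Cℤ (4 ℕ.+ s) z + Cℤ a z                           ≡⟨ cong (_+ Cℤ a z) (Cℤ-at z (index₅ k a)) ⟩
      Cℤ (2 ℕ.+ k ℕ.+ (2 ℕ.+ k ℕ.+ a)) z + Cℤ a z       ∎

  Cℤ-∘ : ∀ m n z → Cℤ m (Cℤ n z) ≡ Cℤ (m ℕ.* n) z
  Cℤ-∘ zero n z = refl
  Cℤ-∘ (suc zero) n z = trans (Cℤ-1 (Cℤ n z)) (Cℤ-at z (sym (ℕ.+-identityʳ n)))
  Cℤ-∘ (suc (suc m)) n z = begin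
    Cℤ (2 ℕ.+ m) y                                  ≡⟨ Cℤ-recurrence m y ⟩
    y * Cℤ (suc m) y - Cℤ m y                       ≡⟨ cong₂ (λ s t → y * s - t) (Cℤ-∘ (suc m) n z) (Cℤ-∘ m n z) ⟩
    y * Cℤ (n ℕ.+ mn) z - Cℤ mn z                   ≡⟨ cong (_- Cℤ mn z) (ℤ.*-comm y _) ⟩
    Cℤ (n ℕ.+ mn) z * y - Cℤ mn z                   ≡⟨ cong (_- Cℤ mn z) (Cℤ-product n mn z) ⟩
    (Cℤ (n ℕ.+ (n ℕ.+ mn)) z + Cℤ mn z) - Cℤ mn z   ≡⟨ cancel _ _ ⟩
    Cℤ (n ℕ.+ (n ℕ.+ mn)) z                         ∎
    where
    y = Cℤ n z
    mn = m ℕ.* n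
    cancel : ∀ a b → (a + b) - b ≡ a
    cancel = solve-∀

  Cℤ-∘-comm : ∀ m n z → Cℤ m (Cℤ n z) ≡ Cℤ n (Cℤ m z)
  Cℤ-∘-comm m n z = begin
    Cℤ m (Cℤ n z)   ≡⟨ Cℤ-∘ m n z ⟩
    Cℤ (m ℕ.* n) z  ≡⟨ Cℤ-at z (ℕ.*-comm m n) ⟩
    Cℤ (n ℕ.* m) z  ≡⟨ Cℤ-∘ n m z ⟨
    Cℤ n (Cℤ m z)   ∎

  Uℤ-cassini : ∀ n z → Uℤ (suc n) z * Uℤ (suc n) z - z * Uℤ (suc n) z * Uℤ n z + Uℤ n z * Uℤ n z ≡ + 1
  Uℤ-cassini zero z = base z
    where
    base : ∀ z → + 1 * + 1 - z * + 1 * + 0 + + 0 * + 0 ≡ + 1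
    base = solve-∀
  Uℤ-cassini (suc n) z = trans (step z (Uℤ (suc n) z) (Uℤ n z)) (Uℤ-cassini n z)
    where
    step : ∀ z a b → (z * a - b) * (z * a - b) - z * (z * a - b) * a + a * a ≡ a * a - z * a * b + b * b
    step = solve-∀

  Recurrent : ℤ → (ℕ → ℤ) → Set
  Recurrent z s = ∀ n → s (suc (suc n)) ≡ z * s (suc n) - s n

  recurrent-shift : ∀ z s → Recurrent z s → ∀ m n → s (m ℕ.+ suc n) ≡ Uℤ (suc m) z * s (suc n) - Uℤ m z * s n
  recurrent-shift z s rec zero n = unit (s (suc n)) (s n)
    where
    unit : ∀ a b → a ≡ + 1 * a - + 0 * b
    unit = solve-∀
  recurrent-shift z s rec (suc zero) n = trans (rec n) (unfold z (s (suc n)) (s n))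
    where
    unfold : ∀ z a b → z * a - b ≡ (z * + 1 - + 0) * a - + 1 * b
    unfold = solve-∀
  recurrent-shift z s rec (suc (suc m)) n = begin
    s (2 ℕ.+ m ℕ.+ suc n)                       ≡⟨ rec (m ℕ.+ suc n) ⟩
    z * s (suc m ℕ.+ suc n) - s (m ℕ.+ suc n)
      ≡⟨ cong₂ (λ a b → z * a - b) (recurrent-shift z s rec (suc m) n) (recurrent-shift z s rec m n) ⟩
    z * (Uℤ (2 ℕ.+ m) z * s (suc n) - Uℤ (suc m) z * s n) - (Uℤ (suc m) z * s (suc n) - Uℤ m z * s n)
      ≡⟨ regroup z (Uℤ (2 ℕ.+ m) z) (Uℤ (suc m) z) (Uℤ m z) (s (suc n)) (s n) ⟩
    Uℤ (3 ℕ.+ m) z * s (suc n) - Uℤ (2 ℕ.+ m) z * s n  ∎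
    where
    regroup : ∀ z u₂ u₁ u₀ a b → z * (u₂ * a - u₁ * b) - (u₁ * a - u₀ * b) ≡ (z * u₂ - u₁) * a - (z * u₁ - u₀) * b
    regroup = solve-∀

  Cℤ-suc-via-Uℤ : ∀ k z → Cℤ (suc k) z ≡ z * Uℤ (suc k) z - + 2 * Uℤ k z
  Cℤ-suc-via-Uℤ k z = regroup z (Uℤ (suc k) z) (Uℤ k z)
    where
    regroup : ∀ z a b → (z * a - b) - b ≡ z * a - + 2 * b
    regroup = solve-∀

  Cℤ-via-Uℤ : ∀ k z → Cℤ k z ≡ + 2 * Uℤ (suc k) z - z * Uℤ k z
  Cℤ-via-Uℤ zero z = base z
    where
    base : ∀ z → + 2 ≡ + 2 * + 1 - z * + 0
    base = solve-∀
  Cℤ-via-Uℤ (suc k) z = regroup z (Uℤ (suc k) z) (Uℤ k z)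
    where
    regroup : ∀ z a b → (z * a - b) - b ≡ + 2 * (z * a - b) - z * a
    regroup = solve-∀

  Cℤ-odd : ∀ k z → Cℤ (suc (2 ℕ.* k)) z ≡ Uℤ (suc k) z * (z * Uℤ (suc k) z - + 2 * Uℤ k z)
                                           - Uℤ k z * (+ 2 * Uℤ (suc k) z - z * Uℤ k z)
  Cℤ-odd k z = begin
    Cℤ (suc (2 ℕ.* k)) z                               ≡⟨ Cℤ-at z (index k) ⟩
    Cℤ (k ℕ.+ suc k) z                                 ≡⟨ recurrent-shift z (λ n → Cℤ n z) (λ n → Cℤ-recurrence n z) k k ⟩
    Uℤ (suc k) z * Cℤ (suc k) z - Uℤ k z * Cℤ k z      ≡⟨ cong₂ (λ c c′ → Uℤ (suc k) z * c - Uℤ k z * c′)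
                                                                (Cℤ-suc-via-Uℤ k z) (Cℤ-via-Uℤ k z) ⟩
    Uℤ (suc k) z * (z * Uℤ (suc k) z - + 2 * Uℤ k z) - Uℤ k z * (+ 2 * Uℤ (suc k) z - z * Uℤ k z) ∎
    where
    index : ∀ k → suc (2 ℕ.* k) ≡ k ℕ.+ suc k
    index = ℕ-solve-∀

  Cℤ-odd-2 : ∀ k z → Cℤ (suc (2 ℕ.* k)) z - + 2 ≡ (z - + 2) * (Wℤ k z * Wℤ k z)
  Cℤ-odd-2 k z = begin
    Cℤ (suc (2 ℕ.* k)) z - + 2                                            ≡⟨ cong (_- + 2) (Cℤ-odd k z) ⟩
    (a * (z * a - + 2 * b) - b * (+ 2 * a - z * b)) - + 2                 ≡⟨ expand z a b ⟩
    (z - + 2) * ((a + b) * (a + b)) + + 2 * ((a * a - z * a * b + b * b) - + 1)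
      ≡⟨ cong (λ c → (z - + 2) * ((a + b) * (a + b)) + + 2 * (c - + 1)) (Uℤ-cassini k z) ⟩
    (z - + 2) * ((a + b) * (a + b)) + + 2 * (+ 1 - + 1)                   ≡⟨ ℤ.+-identityʳ _ ⟩
    (z - + 2) * (Wℤ k z * Wℤ k z)                                         ∎
    where
    a = Uℤ (suc k) z
    b = Uℤ k z
    expand : ∀ z a b → (a * (z * a - + 2 * b) - b * (+ 2 * a - z * b)) - + 2
                     ≡ (z - + 2) * ((a + b) * (a + b)) + + 2 * ((a * a - z * a * b + b * b) - + 1)
    expand = solve-∀

  Cℤ-odd+2 : ∀ k z → Cℤ (suc (2 ℕ.* k)) z + + 2 ≡ (z + + 2) * (Vℤ k z * Vℤ k z)
  Cℤ-odd+2 k z = begin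
    Cℤ (suc (2 ℕ.* k)) z + + 2                                            ≡⟨ cong (_+ + 2) (Cℤ-odd k z) ⟩
    (a * (z * a - + 2 * b) - b * (+ 2 * a - z * b)) + + 2                 ≡⟨ expand z a b ⟩
    (z + + 2) * ((a - b) * (a - b)) - + 2 * ((a * a - z * a * b + b * b) - + 1)
      ≡⟨ cong (λ c → (z + + 2) * ((a - b) * (a - b)) - + 2 * (c - + 1)) (Uℤ-cassini k z) ⟩
    (z + + 2) * ((a - b) * (a - b)) - + 2 * (+ 1 - + 1)                   ≡⟨ ℤ.+-identityʳ _ ⟩
    (z + + 2) * (Vℤ k z * Vℤ k z)                                         ∎
    where
    a = Uℤ (suc k) z
    b = Uℤ k z
    expand : ∀ z a b → (a * (z * a - + 2 * b) - b * (+ 2 * a - z * b)) + + 2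
                     ≡ (z + + 2) * ((a - b) * (a - b)) - + 2 * ((a * a - z * a * b + b * b) - + 1)
    expand = solve-∀

  Uℤ-neg : ∀ n z → Uℤ n (- z) ≡ - (-1ℤ ^ n * Uℤ n z)
  Uℤ-neg zero z = refl
  Uℤ-neg (suc zero) z = refl
  Uℤ-neg (suc (suc n)) z = trans (cong₂ (λ a b → (- z) * a - b) (Uℤ-neg (suc n) z) (Uℤ-neg n z))
                                 (regroup z (-1ℤ ^ n) (Uℤ (suc n) z) (Uℤ n z))
    where
    regroup : ∀ z s a b → (- z) * (- (-1ℤ * s * a)) - (- (s * b)) ≡ - (-1ℤ * (-1ℤ * s) * (z * a - b))
    regroup = solve-∀

  Cℤ-neg : ∀ n z → Cℤ n (- z) ≡ -1ℤ ^ n * Cℤ n z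
  Cℤ-neg zero z = refl
  Cℤ-neg (suc n) z = trans (cong₂ _-_ (Uℤ-neg (2 ℕ.+ n) z) (Uℤ-neg n z))
                           (regroup (-1ℤ ^ n) (Uℤ (2 ℕ.+ n) z) (Uℤ n z))
    where
    regroup : ∀ s a b → - (-1ℤ * (-1ℤ * s) * a) - (- (s * b)) ≡ -1ℤ * s * (a - b)
    regroup = solve-∀

  Vℤ-neg : ∀ k z → Vℤ k (- z) ≡ -1ℤ ^ k * Wℤ k z
  Vℤ-neg k z = trans (cong₂ _-_ (Uℤ-neg (suc k) z) (Uℤ-neg k z)) (regroup (-1ℤ ^ k) (Uℤ (suc k) z) (Uℤ k z))
    where
    regroup : ∀ s a b → - (-1ℤ * s * a) - (- (s * b)) ≡ s * (a + b)
    regroup = solve-∀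

  Wℤ-neg : ∀ k z → Wℤ k (- z) ≡ -1ℤ ^ k * Vℤ k z
  Wℤ-neg k z = trans (cong₂ _+_ (Uℤ-neg (suc k) z) (Uℤ-neg k z)) (regroup (-1ℤ ^ k) (Uℤ (suc k) z) (Uℤ k z))
    where
    regroup : ∀ s a b → - (-1ℤ * s * a) + (- (s * b)) ≡ s * (a - b)
    regroup = solve-∀

  -1^n*-1^n≡1 : ∀ n → -1ℤ ^ n * -1ℤ ^ n ≡ + 1
  -1^n*-1^n≡1 zero = refl
  -1^n*-1^n≡1 (suc n) = trans (regroup (-1ℤ ^ n)) (-1^n*-1^n≡1 n)
    where
    regroup : ∀ s → (-1ℤ * s) * (-1ℤ * s) ≡ s * s
    regroup = solve-∀

  -1^odd≡-1 : ∀ m → -1ℤ ^ suc (2 ℕ.* m) ≡ -1ℤ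
  -1^odd≡-1 m = cong (-1ℤ *_) (trans (sym (ℤ.^-*-assoc -1ℤ 2 m)) (ℤ.^-zeroˡ m))

  Uℤ-at-2 : ∀ n → Uℤ n (+ 2) ≡ + n
  Uℤ-at-2 zero = refl
  Uℤ-at-2 (suc zero) = refl
  Uℤ-at-2 (suc (suc n)) = trans (cong₂ (λ a b → + 2 * a - b) (Uℤ-at-2 (suc n)) (Uℤ-at-2 n)) (regroup (+ n))
    where
    regroup : ∀ x → + 2 * (+ 1 + x) - x ≡ + 1 + (+ 1 + x)
    regroup = solve-∀

  Cℤ-at-2 : ∀ n → Cℤ n (+ 2) ≡ + 2
  Cℤ-at-2 zero = refl
  Cℤ-at-2 (suc zero) = refl
  Cℤ-at-2 (suc (suc n)) = trans (Cℤ-recurrence n (+ 2)) (cong₂ (λ a b → + 2 * a - b) (Cℤ-at-2 (suc n)) (Cℤ-at-2 n))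

  Cℤ-odd-at-0 : ∀ m → Cℤ (suc (2 ℕ.* m)) (+ 0) ≡ + 0
  Cℤ-odd-at-0 zero = refl
  Cℤ-odd-at-0 (suc m) = begin
    Cℤ (suc (2 ℕ.* suc m)) (+ 0)        ≡⟨ Cℤ-at (+ 0) (cong suc (ℕ.*-suc 2 m)) ⟩
    Cℤ (3 ℕ.+ 2 ℕ.* m) (+ 0)            ≡⟨ Cℤ-recurrence (suc (2 ℕ.* m)) (+ 0) ⟩
    + 0 * Cℤ (2 ℕ.+ 2 ℕ.* m) (+ 0) - Cℤ (suc (2 ℕ.* m)) (+ 0)  ≡⟨ cong (λ c → + 0 - c) (Cℤ-odd-at-0 m) ⟩
    + 0                                 ∎

  Cℤ-odd-at--2 : ∀ m → Cℤ (suc (2 ℕ.* m)) (- + 2) ≡ - + 2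
  Cℤ-odd-at--2 m = trans (Cℤ-neg (suc (2 ℕ.* m)) (+ 2)) (cong₂ _*_ (-1^odd≡-1 m) (Cℤ-at-2 (suc (2 ℕ.* m))))

  Wℤ-at-2 : ∀ k → Wℤ k (+ 2) ≡ + suc (2 ℕ.* k)
  Wℤ-at-2 k = trans (cong₂ _+_ (Uℤ-at-2 (suc k)) (Uℤ-at-2 k)) (cong +_ (index k))
    where
    index : ∀ k → suc k ℕ.+ k ≡ suc (2 ℕ.* k)
    index = ℕ-solve-∀

  ∣+0 : ∀ {k} → k ∣ + 0
  ∣+0 = divides (+ 0) refl

  Uℤ-cong-∣ : ∀ n x y → (x - y) ∣ (Uℤ n x - Uℤ n y)
  Uℤ-cong-∣ zero x y = ∣+0
  Uℤ-cong-∣ (suc zero) x y = ∣+0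
  Uℤ-cong-∣ (suc (suc n)) x y =
    subst ((x - y) ∣_) (sym (regroup x y (Uℤ (suc n) x) (Uℤ (suc n) y) (Uℤ n x) (Uℤ n y)))
      (∣m∣n⇒∣m-n (∣m∣n⇒∣m+n (∣n⇒∣m*n x (Uℤ-cong-∣ (suc n) x y)) (∣m⇒∣m*n (Uℤ (suc n) y) ∣-refl))
                 (Uℤ-cong-∣ n x y))
    where
    regroup : ∀ x y a b c d → (x * a - c) - (y * b - d) ≡ (x * (a - b) + (x - y) * b) - (c - d)
    regroup = solve-∀

  ∣-sub-sub : ∀ {k} a b c d → k ∣ a - b → k ∣ c - d → k ∣ (a - c) - (b - d)
  ∣-sub-sub {k} a b c d k∣a-b k∣c-d = subst (k ∣_) (regroup a b c d) (∣m∣n⇒∣m-n k∣a-b k∣c-d)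
    where
    regroup : ∀ a b c d → (a - b) - (c - d) ≡ (a - c) - (b - d)
    regroup = solve-∀

  ∣-add-add : ∀ {k} a b c d → k ∣ a - b → k ∣ c - d → k ∣ (a + c) - (b + d)
  ∣-add-add {k} a b c d k∣a-b k∣c-d = subst (k ∣_) (regroup a b c d) (∣m∣n⇒∣m+n k∣a-b k∣c-d)
    where
    regroup : ∀ a b c d → (a - b) + (c - d) ≡ (a + c) - (b + d)
    regroup = solve-∀

  Cℤ-cong-∣ : ∀ n x y → (x - y) ∣ (Cℤ n x - Cℤ n y)
  Cℤ-cong-∣ zero x y = ∣+0
  Cℤ-cong-∣ (suc n) x y = ∣-sub-sub (Uℤ (2 ℕ.+ n) x) (Uℤ (2 ℕ.+ n) y) (Uℤ n x) (Uℤ n y)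
    (Uℤ-cong-∣ (2 ℕ.+ n) x y) (Uℤ-cong-∣ n x y)

  Vℤ-cong-∣ : ∀ k x y → (x - y) ∣ (Vℤ k x - Vℤ k y)
  Vℤ-cong-∣ k x y = ∣-sub-sub (Uℤ (suc k) x) (Uℤ (suc k) y) (Uℤ k x) (Uℤ k y)
    (Uℤ-cong-∣ (suc k) x y) (Uℤ-cong-∣ k x y)

  Wℤ-cong-∣ : ∀ k x y → (x - y) ∣ (Wℤ k x - Wℤ k y)
  Wℤ-cong-∣ k x y = ∣-add-add (Uℤ (suc k) x) (Uℤ (suc k) y) (Uℤ k x) (Uℤ k y)
    (Uℤ-cong-∣ (suc k) x y) (Uℤ-cong-∣ k x y)

  ∣-sub-cancel : ∀ {k a b} → k ∣ a - b → k ∣ b → k ∣ a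
  ∣-sub-cancel {k} {a} {b} k∣a-b k∣b = subst (k ∣_) (regroup a b) (∣m∣n⇒∣m+n k∣a-b k∣b)
    where
    regroup : ∀ a b → (a - b) + b ≡ a
    regroup = solve-∀

  ∣-Cℤ-fixed : ∀ {k} n {c x} → Cℤ n c ≡ c → k ∣ x - c → k ∣ Cℤ n x - c
  ∣-Cℤ-fixed {k} n {c} {x} Cc≡c k∣x-c = subst (λ d → k ∣ Cℤ n x - d) Cc≡c (∣-trans k∣x-c (Cℤ-cong-∣ n x c))

  ∣-Cℤ-root : ∀ {k} n {x} → Cℤ n (+ 0) ≡ + 0 → k ∣ x → k ∣ Cℤ n x
  ∣-Cℤ-root {k} n {x} C0≡0 k∣x =
    subst (k ∣_) (ℤ.+-identityʳ (Cℤ n x)) (∣-Cℤ-fixed n C0≡0 (subst (k ∣_) (sym (ℤ.+-identityʳ x)) k∣x))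

  ∣-1^n*⇔∣ : ∀ {k} n x → k ∣ -1ℤ ^ n * x ⇔ k ∣ x
  ∣-1^n*⇔∣ {k} n x = mk⇔ (λ k∣sx → subst (k ∣_) (cancel n x) (∣n⇒∣m*n (-1ℤ ^ n) k∣sx)) (∣n⇒∣m*n (-1ℤ ^ n))
    where
    cancel : ∀ n x → -1ℤ ^ n * (-1ℤ ^ n * x) ≡ x
    cancel n x = trans (sym (ℤ.*-assoc (-1ℤ ^ n) _ x)) (trans (cong (_* x) (-1^n*-1^n≡1 n)) (ℤ.*-identityˡ x))

  module _ (P : ℤ → Set) (f : ℕ → ℕ) (n : ℕ) where

    Σ-Cℤ-∘ : ∀ (f′ : ℕ → ℕ) → (∀ k → f k ℕ.* n ≡ f′ k) → ∀ z →
             (Σ ℕ λ k → P (Cℤ (f k) (Cℤ n z))) ⇔ (Σ ℕ λ k → P (Cℤ (f′ k) z))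
    Σ-Cℤ-∘ f′ fn≡f′ z = mk⇔ (λ (k , Pk) → k , subst P (eq k) Pk) (λ (k , Pk) → k , subst P (sym (eq k)) Pk)
      where
      eq : ∀ k → Cℤ (f k) (Cℤ n z) ≡ Cℤ (f′ k) z
      eq k = trans (Cℤ-∘ (f k) n z) (Cℤ-at z (fn≡f′ k))

    Σ-Cℤ-invariant : ∀ (g : ℕ → ℕ) → (∀ k → f k ℕ.* n ≡ f (g k)) → (∀ {x} → P x → P (Cℤ n x)) → ∀ z →
                     (Σ ℕ λ k → P (Cℤ (f k) (Cℤ n z))) ⇔ (Σ ℕ λ k → P (Cℤ (f k) z))
    Σ-Cℤ-invariant g fn≡fg P-Cℤ z = mk⇔
      (λ (k , Pk) → g k , subst P (trans (Cℤ-∘ (f k) n z) (Cℤ-at z (fn≡fg k))) Pk)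
      (λ (k , Pk) → k , subst P (Cℤ-∘-comm n (f k) z) (P-Cℤ Pk))

  Σ-∣-sign : ∀ {d} (a b : ℕ → ℤ) (e : ℕ → ℕ) → (∀ k → a k ≡ -1ℤ ^ e k * b k) →
             (Σ ℕ λ k → d ∣ a k) ⇔ (Σ ℕ λ k → d ∣ b k)
  Σ-∣-sign {d} a b e a≡±b = mk⇔
    (λ (k , d∣a) → k , Equivalence.to (∣-1^n*⇔∣ (e k) (b k)) (subst (d ∣_) (a≡±b k) d∣a))
    (λ (k , d∣b) → k , subst (d ∣_) (sym (a≡±b k)) (Equivalence.from (∣-1^n*⇔∣ (e k) (b k)) d∣b))

module Residues (p : ℕ) (p-prime : Prime p) where

  open Chebyshevℤ
  open import Data.Nat.Primality using (euclidsLemma)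
  import Data.Nat.Divisibility as ℕ
  open import Data.Integer using (ℤ; +_; -1ℤ; _+_; _*_; _-_; -_; _^_)
  import Data.Integer.Properties as ℤ
  open import Data.Integer.Divisibility.Signed using (_∣_; ∣ᵤ⇒∣; ∣⇒∣ᵤ; ∣n⇒∣m*n; ∣m⇒∣m*n; ∣-trans; ∣-refl)
  open import Data.Integer.Tactic.RingSolver using (solve-∀)
  open import Data.Sum using (_⊎_; [_,_]′)
  import Data.Sum as Sum
  open import Data.Sum.Function.Propositional using (_⊎-⇔_)
  open import Function.Properties.Equivalence using (⇔-setoid)
  open import Level using (0ℓ)
  open import Relation.Binary.Reasoning.Setoid (⇔-setoid 0ℓ)

  private
    odd*odd : ∀ k m → suc (2 ℕ.* k) ℕ.* suc (2 ℕ.* m) ≡ suc (2 ℕ.* (k ℕ.* suc (2 ℕ.* m) ℕ.+ m))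
    odd*odd = ℕ-solve-∀

  euclidsLemmaℤ : ∀ x y → + p ∣ x * y → + p ∣ x ⊎ + p ∣ y
  euclidsLemmaℤ x y p∣xy =
    Sum.map ∣ᵤ⇒∣ ∣ᵤ⇒∣ (euclidsLemma _ _ p-prime (subst (p ℕ.∣_) (ℤ.abs-* x y) (∣⇒∣ᵤ p∣xy)))

  ∣x*x⇒∣x : ∀ x → + p ∣ x * x → + p ∣ x
  ∣x*x⇒∣x x p∣xx = [ (λ h → h) , (λ h → h) ]′ (euclidsLemmaℤ x x p∣xx)

  Πℤ : ℕ → ℤ → Set
  Πℤ zero z = Σ ℕ λ k → + p ∣ Wℤ k z
  Πℤ (suc zero) z = Σ ℕ λ k → + p ∣ Vℤ k z
  Πℤ (suc (suc j)) z = Σ ℕ λ m → + p ∣ Cℤ (2 ℕ.^ j ℕ.* suc (2 ℕ.* m)) z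

  C-odd≡ : ℤ → ℤ → Set
  C-odd≡ c z = Σ ℕ λ k → + p ∣ Cℤ (suc (2 ℕ.* k)) z - c

  Cℤ-C₂ : ∀ n z → Cℤ n (Cℤ 2 z) ≡ Cℤ n z * Cℤ n z - + 2
  Cℤ-C₂ n z = trans (Cℤ-∘-comm n 2 z) (Cℤ-2 (Cℤ n z))

  C-odd≡2-C₂ : ∀ z → C-odd≡ (+ 2) (Cℤ 2 z) ⇔ (C-odd≡ (+ 2) z ⊎ C-odd≡ (- + 2) z)
  C-odd≡2-C₂ z = mk⇔
    (λ (k , p∣) → Sum.map (k ,_) (k ,_) (euclidsLemmaℤ _ _ (subst (+ p ∣_) (factor k) p∣)))
    [ (λ (k , p∣x-2) → k , subst (+ p ∣_) (sym (factor k)) (∣m⇒∣m*n (Cℤ (suc (2 ℕ.* k)) z - - + 2) p∣x-2))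
    , (λ (k , p∣x+2) → k , subst (+ p ∣_) (sym (factor k)) (∣n⇒∣m*n (Cℤ (suc (2 ℕ.* k)) z - + 2) p∣x+2)) ]′
    where
    difference-of-squares : ∀ x → (x * x - + 2) - + 2 ≡ (x - + 2) * (x - - + 2)
    difference-of-squares = solve-∀
    factor : ∀ k → Cℤ (suc (2 ℕ.* k)) (Cℤ 2 z) - + 2 ≡ (Cℤ (suc (2 ℕ.* k)) z - + 2) * (Cℤ (suc (2 ℕ.* k)) z - - + 2)
    factor k = trans (cong (_- + 2) (Cℤ-C₂ (suc (2 ℕ.* k)) z)) (difference-of-squares (Cℤ (suc (2 ℕ.* k)) z))

  C-odd≡-2-C₂ : ∀ z → C-odd≡ (- + 2) (Cℤ 2 z) ⇔ Πℤ 2 z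
  C-odd≡-2-C₂ z = mk⇔
    (λ (k , p∣) → k , subst (+ p ∣_) (index k) (∣x*x⇒∣x (Cℤ (suc (2 ℕ.* k)) z) (subst (+ p ∣_) (square k) p∣)))
    (λ (k , p∣) → k , subst (+ p ∣_) (sym (square k)) (∣m⇒∣m*n (Cℤ (suc (2 ℕ.* k)) z) (subst (+ p ∣_) (sym (index k)) p∣)))
    where
    cancel : ∀ x → (x * x - + 2) - - + 2 ≡ x * x
    cancel = solve-∀
    square : ∀ k → Cℤ (suc (2 ℕ.* k)) (Cℤ 2 z) - - + 2 ≡ Cℤ (suc (2 ℕ.* k)) z * Cℤ (suc (2 ℕ.* k)) z
    square k = trans (cong (_- - + 2) (Cℤ-C₂ (suc (2 ℕ.* k)) z)) (cancel (Cℤ (suc (2 ℕ.* k)) z))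
    index : ∀ k → Cℤ (suc (2 ℕ.* k)) z ≡ Cℤ (1 ℕ.* suc (2 ℕ.* k)) z
    index k = Cℤ-at z (sym (ℕ.*-identityˡ (suc (2 ℕ.* k))))

  Πℤ-≥2-C₂ : ∀ j z → Πℤ (2 ℕ.+ j) (Cℤ 2 z) ⇔ Πℤ (3 ℕ.+ j) z
  Πℤ-≥2-C₂ j = Σ-Cℤ-∘ (+ p ∣_) (λ m → 2 ℕ.^ j ℕ.* suc (2 ℕ.* m)) 2 _ λ m → doubling (2 ℕ.^ j) (suc (2 ℕ.* m))
    where
    doubling : ∀ a b → a ℕ.* b ℕ.* 2 ≡ 2 ℕ.* a ℕ.* b
    doubling = ℕ-solve-∀

  module _ (m : ℕ) where

    private
      n = suc (2 ℕ.* m)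

    C-odd≡-Codd : ∀ {c} → Cℤ n c ≡ c → ∀ z → C-odd≡ c (Cℤ n z) ⇔ C-odd≡ c z
    C-odd≡-Codd {c} Cc≡c = Σ-Cℤ-invariant (λ x → + p ∣ x - c) (λ k → suc (2 ℕ.* k)) n (λ k → k ℕ.* n ℕ.+ m)
                             (λ k → odd*odd k m) (λ {x} → ∣-Cℤ-fixed n {c} {x} Cc≡c)

    Πℤ-≥2-Codd : ∀ j z → Πℤ (2 ℕ.+ j) (Cℤ n z) ⇔ Πℤ (2 ℕ.+ j) z
    Πℤ-≥2-Codd j = Σ-Cℤ-invariant (+ p ∣_) (λ k → 2 ℕ.^ j ℕ.* suc (2 ℕ.* k)) n (λ k → k ℕ.* n ℕ.+ m)
                  (λ k → trans (ℕ.*-assoc (2 ℕ.^ j) _ n) (cong (2 ℕ.^ j ℕ.*_) (odd*odd k m)))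
                  (∣-Cℤ-root n (Cℤ-odd-at-0 m))

  Πℤ₀-neg : ∀ z → Πℤ 0 (- z) ⇔ Πℤ 1 z
  Πℤ₀-neg z = Σ-∣-sign (λ k → Wℤ k (- z)) (λ k → Vℤ k z) (λ k → k) (λ k → Wℤ-neg k z)

  Πℤ₁-neg : ∀ z → Πℤ 1 (- z) ⇔ Πℤ 0 z
  Πℤ₁-neg z = Σ-∣-sign (λ k → Vℤ k (- z)) (λ k → Wℤ k z) (λ k → k) (λ k → Vℤ-neg k z)

  Πℤ-≥2-neg : ∀ j z → Πℤ (2 ℕ.+ j) (- z) ⇔ Πℤ (2 ℕ.+ j) z
  Πℤ-≥2-neg j z = Σ-∣-sign (λ m → Cℤ (N m) (- z)) (λ m → Cℤ (N m) z) N (λ m → Cℤ-neg (N m) z)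
    where
    N : ℕ → ℕ
    N m = 2 ℕ.^ j ℕ.* suc (2 ℕ.* m)

  module Odd {h : ℕ} (p≡2h+1 : p ≡ suc (2 ℕ.* h)) where

    p∣Wℤ-at-2 : + p ∣ Wℤ h (+ 2)
    p∣Wℤ-at-2 = subst (+ p ∣_) (trans (cong +_ p≡2h+1) (sym (Wℤ-at-2 h))) ∣-refl

    Πℤ₀⇔C-odd≡2 : ∀ z → Πℤ 0 z ⇔ C-odd≡ (+ 2) z
    Πℤ₀⇔C-odd≡2 z = mk⇔
      (λ (k , p∣W) → k , subst (+ p ∣_) (sym (Cℤ-odd-2 k z)) (∣n⇒∣m*n (z - + 2) (∣m⇒∣m*n (Wℤ k z) p∣W)))
      (λ (k , p∣C-2) → [ (λ p∣z-2 → h , ∣-sub-cancel (∣-trans p∣z-2 (Wℤ-cong-∣ h z (+ 2))) p∣Wℤ-at-2)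
                       , (λ p∣WW → k , ∣x*x⇒∣x (Wℤ k z) p∣WW) ]′
                       (euclidsLemmaℤ (z - + 2) _ (subst (+ p ∣_) (Cℤ-odd-2 k z) p∣C-2)))

    Πℤ₁⇔C-odd≡-2 : ∀ z → Πℤ 1 z ⇔ C-odd≡ (- + 2) z
    Πℤ₁⇔C-odd≡-2 z = mk⇔
      (λ (k , p∣V) → k , subst (+ p ∣_) (sym (Cℤ-odd+2 k z)) (∣n⇒∣m*n (z + + 2) (∣m⇒∣m*n (Vℤ k z) p∣V)))
      (λ (k , p∣C+2) → [ (λ p∣z+2 → h , ∣-sub-cancel (∣-trans p∣z+2 (Vℤ-cong-∣ h z (- + 2))) p∣V[-2])
                       , (λ p∣VV → k , ∣x*x⇒∣x (Vℤ k z) p∣VV) ]′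
                       (euclidsLemmaℤ (z + + 2) _ (subst (+ p ∣_) (Cℤ-odd+2 k z) p∣C+2)))
      where
      p∣V[-2] : + p ∣ Vℤ h (- + 2)
      p∣V[-2] = subst (+ p ∣_) (sym (Vℤ-neg h (+ 2))) (∣n⇒∣m*n (-1ℤ ^ h) p∣Wℤ-at-2)

    Πℤ₀-C₂ : ∀ z → Πℤ 0 (Cℤ 2 z) ⇔ (Πℤ 0 z ⊎ Πℤ 1 z)
    Πℤ₀-C₂ z = begin
      Πℤ 0 (Cℤ 2 z)                           ≈⟨ Πℤ₀⇔C-odd≡2 (Cℤ 2 z) ⟩
      C-odd≡ (+ 2) (Cℤ 2 z)                   ≈⟨ C-odd≡2-C₂ z ⟩
      (C-odd≡ (+ 2) z ⊎ C-odd≡ (- + 2) z)     ≈⟨ Πℤ₀⇔C-odd≡2 z ⊎-⇔ Πℤ₁⇔C-odd≡-2 z ⟨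
      (Πℤ 0 z ⊎ Πℤ 1 z)                       ∎

    Πℤ-suc-C₂ : ∀ k z → Πℤ (suc k) (Cℤ 2 z) ⇔ Πℤ (2 ℕ.+ k) z
    Πℤ-suc-C₂ zero z = begin
      Πℤ 1 (Cℤ 2 z)            ≈⟨ Πℤ₁⇔C-odd≡-2 (Cℤ 2 z) ⟩
      C-odd≡ (- + 2) (Cℤ 2 z)  ≈⟨ C-odd≡-2-C₂ z ⟩
      Πℤ 2 z                   ∎
    Πℤ-suc-C₂ (suc j) = Πℤ-≥2-C₂ j

    Πℤ-Codd : ∀ m j z → Πℤ j (Cℤ (suc (2 ℕ.* m)) z) ⇔ Πℤ j z
    Πℤ-Codd m zero z = begin
      Πℤ 0 (Cℤ n z)             ≈⟨ Πℤ₀⇔C-odd≡2 (Cℤ n z) ⟩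
      C-odd≡ (+ 2) (Cℤ n z)     ≈⟨ C-odd≡-Codd m (Cℤ-at-2 n) z ⟩
      C-odd≡ (+ 2) z            ≈⟨ Πℤ₀⇔C-odd≡2 z ⟨
      Πℤ 0 z                    ∎
      where n = suc (2 ℕ.* m)
    Πℤ-Codd m (suc zero) z = begin
      Πℤ 1 (Cℤ n z)             ≈⟨ Πℤ₁⇔C-odd≡-2 (Cℤ n z) ⟩
      C-odd≡ (- + 2) (Cℤ n z)   ≈⟨ C-odd≡-Codd m (Cℤ-odd-at--2 m) z ⟩
      C-odd≡ (- + 2) z          ≈⟨ Πℤ₁⇔C-odd≡-2 z ⟨
      Πℤ 1 z                    ∎
      where n = suc (2 ℕ.* m)
    Πℤ-Codd m (suc (suc j)) = Πℤ-≥2-Codd m j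

module Reduction (p : ℕ) (p-prime : Prime p) where

  open Chebyshevℤ
  open Residues p p-prime using (euclidsLemmaℤ; Πℤ)
  open import Data.Nat.Divisibility using (_∣_; ∣1⇒≡1)
  open import Data.Nat.Primality using (euclidsLemma; prime⇒irreducible; ¬prime[1])
  open import Data.Nat.Coprimality using (Coprime; coprime-Bézout; recompute; 0-coprimeTo-m⇒m≡1)
  open import Data.Nat.GCD using (module Bézout)
  open import Data.Integer as ℤ using (ℤ; +_; +[1+_]; -[1+_]; _+_; _*_; _-_; -_)
  import Data.Integer.Properties as ℤ
  import Data.Integer.Divisibility.Signed as ℤ
  open import Data.Integer.Divisibility.Signed using (∣ᵤ⇒∣; ∣⇒∣ᵤ; ∣m∣n⇒∣m+n; ∣m∣n⇒∣m-n; ∣m⇒∣-m; ∣n⇒∣m*n; ∣m⇒∣m*n)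
  open import Data.Integer.Tactic.RingSolver using (solve-∀)
  open import Data.Rational as ℚ using (ℚ; mkℚ; ↥_; ↧_; ↧ₙ_; 0ℚ; 1ℚ; toℚᵘ; 1/_)
  import Data.Rational.Properties as ℚ
  import Data.Rational.Unnormalised as ℚᵘ
  open import Data.Rational.Solver using (module +-*-Solver)
  open +-*-Solver using (solve; _:+_; _:*_; _:-_; con; _:=_)
  open import Algebra.Definitions.RawSemiring ℚ.+-*-rawSemiring using (_^_)
  open import Data.Sum using ([_,_]′)
  open import Data.Empty using (⊥-elim)
  open import Relation.Nullary using (¬_)

  ≃ᵘ-cross : ∀ x u → toℚᵘ x ℚᵘ.≃ u → ↥ x * ℚᵘ.↧ u ≡ ℚᵘ.↥ u * ↧ x
  ≃ᵘ-cross x@record{} u (ℚᵘ.*≡* eq) = eq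

  Cℚ-recurrence : ∀ n q → C (2 ℕ.+ n) q ≡ q ℚ.* C (suc n) q ℚ.- C n q
  Cℚ-recurrence zero q = unfold q
    where
    unfold : ∀ q → (q ℚ.* (q ℚ.* 1ℚ ℚ.- 0ℚ) ℚ.- 1ℚ) ℚ.- 1ℚ ≡ q ℚ.* ((q ℚ.* 1ℚ ℚ.- 0ℚ) ℚ.- 0ℚ) ℚ.- (1ℚ ℚ.+ 1ℚ)
    unfold = solve 1 (λ q → (q :* (q :* con 1ℚ :- con 0ℚ) :- con 1ℚ) :- con 1ℚ
                          := q :* ((q :* con 1ℚ :- con 0ℚ) :- con 0ℚ) :- (con 1ℚ :+ con 1ℚ)) refl
  Cℚ-recurrence (suc n) q = regroup q (U (3 ℕ.+ n) q) (U (2 ℕ.+ n) q) (U (suc n) q) (U n q)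
    where
    regroup : ∀ q a b c d → (q ℚ.* a ℚ.- b) ℚ.- (q ℚ.* c ℚ.- d) ≡ q ℚ.* (a ℚ.- c) ℚ.- (b ℚ.- d)
    regroup = solve 5 (λ q a b c d → (q :* a :- b) :- (q :* c :- d) := q :* (a :- c) :- (b :- d)) refl

  p∤1 : ¬ p ∣ 1
  p∤1 p∣1 = ¬prime[1] (subst Prime (∣1⇒≡1 p∣1) p-prime)

  p∤num∧den : ∀ x → p ∣ ℤ.∣ ↥ x ∣ → ¬ p ∣ ↧ₙ x
  p∤num∧den (mkℚ _ _ coprime) p∣num p∣den = ¬prime[1] (subst Prime (recompute coprime (p∣num , p∣den)) p-prime)

  infix 4 _≈ₚ_
  record _≈ₚ_ (x : ℚ) (z : ℤ) : Set where
    constructor mk≈ₚ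
    field
      p∤den : ¬ p ∣ ↧ₙ x
      p∣num-z*den : + p ℤ.∣ ↥ x - z * ↧ x

  ∤-* : ∀ {a b} → ¬ p ∣ a → ¬ p ∣ b → ¬ p ∣ a ℕ.* b
  ∤-* p∤a p∤b p∣ab = [ p∤a , p∤b ]′ (euclidsLemma _ _ p-prime p∣ab)

  ≈ₚ-fraction : ∀ x z N D → ↥ x * + D ≡ N * ↧ x → ¬ p ∣ D → + p ℤ.∣ N - z * + D → x ≈ₚ z
  ≈ₚ-fraction x z N D cross p∤D p∣N-zD = mk≈ₚ p∤den p∣num-zden
    where
    p∤den : ¬ p ∣ ↧ₙ x
    p∤den p∣den = [ (λ h → p∤num∧den x (∣⇒∣ᵤ h) p∣den) , (λ h → p∤D (∣⇒∣ᵤ h)) ]′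
      (euclidsLemmaℤ (↥ x) (+ D) (subst (+ p ℤ.∣_) (sym cross) (∣n⇒∣m*n N (∣ᵤ⇒∣ p∣den))))
    factor : ↧ x * (N - z * + D) ≡ (↥ x - z * ↧ x) * + D
    factor = begin
      ↧ x * (N - z * + D)         ≡⟨ expand (↧ x) N z (+ D) ⟩
      N * ↧ x - z * ↧ x * + D     ≡⟨ cong (_- z * ↧ x * + D) cross ⟨
      ↥ x * + D - z * ↧ x * + D   ≡⟨ collect (↥ x) (↧ x) z (+ D) ⟩
      (↥ x - z * ↧ x) * + D       ∎
      where
      open ≡-Reasoning
      expand : ∀ d N z D → d * (N - z * D) ≡ N * d - z * d * D
      expand = solve-∀
      collect : ∀ a d z D → a * D - z * d * D ≡ (a - z * d) * D
      collect = solve-∀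
    p∣num-zden : + p ℤ.∣ ↥ x - z * ↧ x
    p∣num-zden = [ (λ h → h) , (λ h → ⊥-elim (p∤D (∣⇒∣ᵤ h))) ]′
      (euclidsLemmaℤ (↥ x - z * ↧ x) (+ D) (subst (+ p ℤ.∣_) factor (∣n⇒∣m*n (↧ x) p∣N-zD)))

  ≈ₚ-+ : ∀ {x y a b} → x ≈ₚ a → y ≈ₚ b → x ℚ.+ y ≈ₚ a + b
  ≈ₚ-+ {x@record{}} {y@record{}} {a} {b} (mk≈ₚ p∤x p∣x-a) (mk≈ₚ p∤y p∣y-b) =
    ≈ₚ-fraction (x ℚ.+ y) (a + b) (↥ x * ↧ y + ↥ y * ↧ x) (↧ₙ x ℕ.* ↧ₙ y)
      (≃ᵘ-cross (x ℚ.+ y) _ (ℚ.toℚᵘ-homo-+ x y)) (∤-* p∤x p∤y)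
      (subst (+ p ℤ.∣_) (regroup (↥ x) (↥ y) (↧ x) (↧ y) a b) (∣m∣n⇒∣m+n (∣m⇒∣m*n (↧ y) p∣x-a) (∣m⇒∣m*n (↧ x) p∣y-b)))
    where
    regroup : ∀ n n′ d d′ a b → (n - a * d) * d′ + (n′ - b * d′) * d ≡ (n * d′ + n′ * d) - (a + b) * (d * d′)
    regroup = solve-∀

  ≈ₚ-* : ∀ {x y a b} → x ≈ₚ a → y ≈ₚ b → x ℚ.* y ≈ₚ a * b
  ≈ₚ-* {x@record{}} {y@record{}} {a} {b} (mk≈ₚ p∤x p∣x-a) (mk≈ₚ p∤y p∣y-b) =
    ≈ₚ-fraction (x ℚ.* y) (a * b) (↥ x * ↥ y) (↧ₙ x ℕ.* ↧ₙ y)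
      (≃ᵘ-cross (x ℚ.* y) _ (ℚ.toℚᵘ-homo-* x y)) (∤-* p∤x p∤y)
      (subst (+ p ℤ.∣_) (regroup (↥ x) (↥ y) (↧ x) (↧ y) a b) (∣m∣n⇒∣m+n (∣m⇒∣m*n (↥ y) p∣x-a) (∣n⇒∣m*n (a * ↧ x) p∣y-b)))
    where
    regroup : ∀ n n′ d d′ a b → (n - a * d) * n′ + a * d * (n′ - b * d′) ≡ n * n′ - a * b * (d * d′)
    regroup = solve-∀

  ≈ₚ-neg : ∀ {x a} → x ≈ₚ a → ℚ.- x ≈ₚ - a
  ≈ₚ-neg {x} {a} (mk≈ₚ p∤x p∣x-a) =
    ≈ₚ-fraction (ℚ.- x) (- a) (- ↥ x) (↧ₙ x) (cong₂ _*_ (ℚ.↥-neg x) (sym (ℚ.↧-neg x))) p∤x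
      (subst (+ p ℤ.∣_) (regroup (↥ x) (↧ x) a) (∣m⇒∣-m p∣x-a))
    where
    regroup : ∀ n d a → - (n - a * d) ≡ - n - - a * d
    regroup = solve-∀

  ≈ₚ-- : ∀ {x y a b} → x ≈ₚ a → y ≈ₚ b → x ℚ.- y ≈ₚ a - b
  ≈ₚ-- x≈a y≈b = ≈ₚ-+ x≈a (≈ₚ-neg y≈b)

  ≈ₚ-0 : 0ℚ ≈ₚ + 0
  ≈ₚ-0 = mk≈ₚ p∤1 ∣+0

  ≈ₚ-1 : 1ℚ ≈ₚ + 1
  ≈ₚ-1 = mk≈ₚ p∤1 ∣+0

  ≈ₚ-U : ∀ {x z} → x ≈ₚ z → ∀ n → U n x ≈ₚ Uℤ n z
  ≈ₚ-U x≈z zero = ≈ₚ-0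
  ≈ₚ-U x≈z (suc zero) = ≈ₚ-1
  ≈ₚ-U x≈z (suc (suc n)) = ≈ₚ-- (≈ₚ-* x≈z (≈ₚ-U x≈z (suc n))) (≈ₚ-U x≈z n)

  C₀≈2 : ∀ {x} → C 0 x ≈ₚ + 2
  C₀≈2 = ≈ₚ-+ ≈ₚ-1 ≈ₚ-1

  ≈ₚ-C : ∀ {x z} → x ≈ₚ z → ∀ n → C n x ≈ₚ Cℤ n z
  ≈ₚ-C {x} x≈z zero = C₀≈2 {x}
  ≈ₚ-C x≈z (suc n) = ≈ₚ-- (≈ₚ-U x≈z (2 ℕ.+ n)) (≈ₚ-U x≈z n)

  ≈ₚ-V : ∀ {x z} → x ≈ₚ z → ∀ k → V k x ≈ₚ Vℤ k z
  ≈ₚ-V x≈z k = ≈ₚ-- (≈ₚ-U x≈z (suc k)) (≈ₚ-U x≈z k)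

  ≈ₚ-W : ∀ {x z} → x ≈ₚ z → ∀ k → W k x ≈ₚ Wℤ k z
  ≈ₚ-W x≈z k = ≈ₚ-+ (≈ₚ-U x≈z (suc k)) (≈ₚ-U x≈z k)

  ≈ₚ-^ : ∀ {x z} → x ≈ₚ z → ∀ n → x ^ n ≈ₚ z ℤ.^ n
  ≈ₚ-^ x≈z zero = ≈ₚ-1
  ≈ₚ-^ x≈z (suc n) = ≈ₚ-* x≈z (≈ₚ-^ x≈z n)

  ≈ₚ-unique : ∀ {x a b} → x ≈ₚ a → x ≈ₚ b → + p ℤ.∣ a - b
  ≈ₚ-unique {x} {a} {b} (mk≈ₚ p∤den p∣x-a) (mk≈ₚ _ p∣x-b) =
    [ (λ h → h) , (λ h → ⊥-elim (p∤den (∣⇒∣ᵤ h))) ]′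
      (euclidsLemmaℤ (a - b) (↧ x) (subst (+ p ℤ.∣_) (regroup (↥ x) (↧ x) a b) (∣m∣n⇒∣m-n p∣x-b p∣x-a)))
    where
    regroup : ∀ n d a b → (n - b * d) - (n - a * d) ≡ (a - b) * d
    regroup = solve-∀

  ZeroMod⇔ : ∀ {x z} → x ≈ₚ z → ZeroMod p x ⇔ + p ℤ.∣ z
  ZeroMod⇔ {x} {z} (mk≈ₚ p∤den p∣x-z) = mk⇔
    (λ p∣num → [ (λ h → h) , (λ h → ⊥-elim (p∤den (∣⇒∣ᵤ h))) ]′
                 (euclidsLemmaℤ z (↧ x) (subst (+ p ℤ.∣_) (cancelˡ (↥ x) (z * ↧ x))
                   (∣m∣n⇒∣m-n (∣ᵤ⇒∣ {+ p} {↥ x} p∣num) p∣x-z))))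
    (λ p∣z → ∣⇒∣ᵤ (∣-sub-cancel {a = ↥ x} p∣x-z (∣m⇒∣m*n (↧ x) p∣z)))
    where
    cancelˡ : ∀ a b → a - (a - b) ≡ b
    cancelˡ = solve-∀

  ≈ₚ-zero : ∀ {x} → ¬ p ∣ ↧ₙ x → ZeroMod p x → x ≈ₚ + 0
  ≈ₚ-zero {x} p∤den p∣num = mk≈ₚ p∤den (subst (+ p ℤ.∣_) (sym (ℤ.+-identityʳ (↥ x))) (∣ᵤ⇒∣ p∣num))

  private
    1+ab≡cd⇒ℤ : ∀ a b c d → 1 ℕ.+ a ℕ.* b ≡ c ℕ.* d → + 1 + + a * + b ≡ + c * + d
    1+ab≡cd⇒ℤ a b c d eq = trans (cong (_+_ (+ 1)) (sym (ℤ.pos-* a b))) (trans (cong +_ eq) (ℤ.pos-* c d))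

  ∤⇒coprime : ∀ d → ¬ p ∣ d → Coprime d p
  ∤⇒coprime d p∤d (i∣d , i∣p) = [ (λ i≡1 → i≡1) , (λ i≡p → ⊥-elim (p∤d (subst (_∣ d) i≡p i∣d))) ]′
                                      (prime⇒irreducible p-prime i∣p)

  inverse-mod-p : ∀ d → ¬ p ∣ d → Σ ℤ λ e → + p ℤ.∣ + d * e - + 1
  inverse-mod-p d p∤d with coprime-Bézout (∤⇒coprime d p∤d)
  ... | Bézout.+- x y 1+yp≡xd =
    + x , subst (+ p ℤ.∣_) (regroup (+ d) (+ x) (+ y) (+ p) (1+ab≡cd⇒ℤ y p x d 1+yp≡xd)) (∣n⇒∣m*n (+ y) ℤ.∣-refl)
    where
    regroup : ∀ d x y p → + 1 + y * p ≡ x * d → y * p ≡ d * x - + 1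
    regroup d x y p eq = trans (uncancel (y * p)) (cong (_- + 1) (trans eq (ℤ.*-comm x d)))
      where
      uncancel : ∀ a → a ≡ (+ 1 + a) - + 1
      uncancel = solve-∀
  ... | Bézout.-+ x y 1+xd≡yp =
    - + x , subst (+ p ℤ.∣_) (regroup (+ d) (+ x) (+ y) (+ p) (1+ab≡cd⇒ℤ x d y p 1+xd≡yp)) (∣m⇒∣-m (∣n⇒∣m*n (+ y) ℤ.∣-refl))
    where
    regroup : ∀ d x y p → + 1 + x * d ≡ y * p → - (y * p) ≡ d * - x - + 1
    regroup d x y p eq = trans (cong -_ (sym eq)) (distribute d x)
      where
      distribute : ∀ d x → - (+ 1 + x * d) ≡ d * - x - + 1
      distribute = solve-∀

  ≈ₚ-exists : ∀ x → ¬ p ∣ ↧ₙ x → Σ ℤ (x ≈ₚ_)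
  ≈ₚ-exists x p∤den with inverse-mod-p (↧ₙ x) p∤den
  ... | e , p∣de-1 = ↥ x * e , mk≈ₚ p∤den (subst (+ p ℤ.∣_) (regroup (↥ x) (↧ x) e) (∣m⇒∣-m (∣n⇒∣m*n (↥ x) p∣de-1)))
    where
    regroup : ∀ n d e → - (n * (d * e - + 1)) ≡ n - n * e * d
    regroup = solve-∀

  module _ {q r : ℚ} (q*r≡1 : q ℚ.* r ≡ 1ℚ) (r≈0 : r ≈ₚ + 0) where

    private
      S : ℕ → ℚ
      S n = r ^ n ℚ.* C n q

      S-recurrence : ∀ n → S (2 ℕ.+ n) ≡ 1ℚ ℚ.* S (suc n) ℚ.- (r ℚ.* r) ℚ.* S n
      S-recurrence n = begin
        r ℚ.* (r ℚ.* P) ℚ.* C (2 ℕ.+ n) q              ≡⟨ cong (r ℚ.* (r ℚ.* P) ℚ.*_) (Cℚ-recurrence n q) ⟩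
        r ℚ.* (r ℚ.* P) ℚ.* (q ℚ.* C₁ ℚ.- C₀)          ≡⟨ regroup q r P C₁ C₀ ⟩
        (q ℚ.* r) ℚ.* S (suc n) ℚ.- (r ℚ.* r) ℚ.* S n  ≡⟨ cong (λ t → t ℚ.* S (suc n) ℚ.- (r ℚ.* r) ℚ.* S n) q*r≡1 ⟩
        1ℚ ℚ.* S (suc n) ℚ.- (r ℚ.* r) ℚ.* S n         ∎
        where
        open ≡-Reasoning
        P = r ^ n
        C₁ = C (suc n) q
        C₀ = C n q
        regroup : ∀ q r P C₁ C₀ → r ℚ.* (r ℚ.* P) ℚ.* (q ℚ.* C₁ ℚ.- C₀)
                                  ≡ (q ℚ.* r) ℚ.* (r ℚ.* P ℚ.* C₁) ℚ.- (r ℚ.* r) ℚ.* (P ℚ.* C₀)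
        regroup = solve 5 (λ q r P C₁ C₀ → r :* (r :* P) :* (q :* C₁ :- C₀)
                                           := (q :* r) :* (r :* P :* C₁) :- (r :* r) :* (P :* C₀)) refl

      S-step : ∀ n {c} → S n ≈ₚ c → S (suc n) ≈ₚ + 1 → S (2 ℕ.+ n) ≈ₚ + 1
      S-step n Sₙ≈c Sₙ₊₁≈1 =
        subst (_≈ₚ + 1) (sym (S-recurrence n)) (≈ₚ-- (≈ₚ-* ≈ₚ-1 Sₙ₊₁≈1) (≈ₚ-* (≈ₚ-* r≈0 r≈0) Sₙ≈c))

      S₁≡1 : S 1 ≡ 1ℚ
      S₁≡1 = trans (unfold q r) q*r≡1
        where
        unfold : ∀ q r → r ℚ.* 1ℚ ℚ.* ((q ℚ.* 1ℚ ℚ.- 0ℚ) ℚ.- 0ℚ) ≡ q ℚ.* r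
        unfold = solve 2 (λ q r → r :* con 1ℚ :* ((q :* con 1ℚ :- con 0ℚ) :- con 0ℚ) := q :* r) refl

      S≈1 : ∀ n → S (suc n) ≈ₚ + 1
      S≈1 zero = subst (_≈ₚ + 1) (sym S₁≡1) ≈ₚ-1
      S≈1 (suc zero) = S-step 0 (≈ₚ-* (≈ₚ-^ r≈0 0) (C₀≈2 {q})) (S≈1 0)
      S≈1 (suc (suc n)) = S-step (suc n) (S≈1 n) (S≈1 (suc n))

    C-has-no-reduction : ∀ n {c} → ¬ C (suc n) q ≈ₚ c
    C-has-no-reduction n C≈c = p∤1 (∣⇒∣ᵤ (≈ₚ-unique (S≈1 n) (≈ₚ-* (≈ₚ-^ r≈0 (suc n)) C≈c)))

    ¬¬p∣↧C : ∀ n → ¬ ¬ p ∣ ↧ₙ (C (suc n) q)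
    ¬¬p∣↧C n p∤↧C = C-has-no-reduction n (proj₂ (≈ₚ-exists (C (suc n) q) p∤↧C))

  1/-≈ₚ0 : ∀ q .{{_ : ℚ.NonZero q}} → p ∣ ↧ₙ q → 1/ q ≈ₚ + 0
  1/-≈ₚ0 q@(mkℚ +[1+ _ ] _ _) p∣↧q = ≈ₚ-zero (λ p∣↥q → p∤num∧den q p∣↥q p∣↧q) p∣↧q
  1/-≈ₚ0 q@(mkℚ -[1+ _ ] _ _) p∣↧q = ≈ₚ-zero (λ p∣↥q → p∤num∧den q p∣↥q p∣↧q) p∣↧q

  p∤↧C⇒p∤↧ : ∀ q n → ¬ p ∣ ↧ₙ (C (suc n) q) → ¬ p ∣ ↧ₙ q
  p∤↧C⇒p∤↧ (mkℚ (+ 0) _ coprime) n _ p∣↧q = p∤1 (subst (p ∣_) (0-coprimeTo-m⇒m≡1 (recompute coprime)) p∣↧q)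
  p∤↧C⇒p∤↧ q@(mkℚ +[1+ _ ] _ _) n p∤↧C p∣↧q = ¬¬p∣↧C (ℚ.*-inverseʳ q) (1/-≈ₚ0 q p∣↧q) n p∤↧C
  p∤↧C⇒p∤↧ q@(mkℚ -[1+ _ ] _ _) n p∤↧C p∣↧q = ¬¬p∣↧C (ℚ.*-inverseʳ q) (1/-≈ₚ0 q p∣↧q) n p∤↧C

  Admissible×Σ⇔Σ : ¬ 2 ∣ p → ∀ {x z} {A B : ℕ → Set} → x ≈ₚ z → (∀ k → A k ⇔ B k) →
                   (Admissible x p × Σ ℕ A) ⇔ Σ ℕ B
  Admissible×Σ⇔Σ p-odd (mk≈ₚ p∤den _) A⇔B = mk⇔
    (λ (_ , k , a) → k , Equivalence.to (A⇔B k) a)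
    (λ (k , b) → (p-prime , p-odd , p∤den) , k , Equivalence.from (A⇔B k) b)

  Pi⇔Πℤ : ¬ 2 ∣ p → ∀ {x z} → x ≈ₚ z → ∀ j → Pi j x p ⇔ Πℤ j z
  Pi⇔Πℤ p-odd x≈z zero = Admissible×Σ⇔Σ p-odd x≈z (λ k → ZeroMod⇔ (≈ₚ-W x≈z k))
  Pi⇔Πℤ p-odd x≈z (suc zero) = Admissible×Σ⇔Σ p-odd x≈z (λ k → ZeroMod⇔ (≈ₚ-V x≈z k))
  Pi⇔Πℤ p-odd x≈z (suc (suc j)) = Admissible×Σ⇔Σ p-odd x≈z (λ m → ZeroMod⇔ (≈ₚ-C x≈z (2 ℕ.^ j ℕ.* suc (2 ℕ.* m))))

open Chebyshevℤ using (Cℤ)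
open import Data.Nat.Divisibility as ℕ using (_∣0; ∣m∣n⇒∣m+n; ∣-refl)
open import Data.Integer using (ℤ) renaming (-_ to -ℤ_)
import Data.Integer.Properties as ℤ
import Data.Rational.Properties as ℚ
open import Data.Sum using ([_,_]′)
open import Data.Sum.Function.Propositional using (_⊎-⇔_)
open import Data.Empty using (⊥-elim)
open import Relation.Nullary using (¬_)
open import Function.Properties.Equivalence using (⇔-setoid)
open import Level using (0ℓ)
open import Relation.Binary.Reasoning.Setoid (⇔-setoid 0ℓ)

open import Data.Nat using (ℕ; suc; _*_; _≥_)
open import Data.Rational using (ℚ; -_)
open import Data.Product using (_×_)
open import Data.Sum using (_⊎_)
open import Function.Bundles using (_⇔_)

odd⇒suc-double : ∀ n → ¬ 2 ℕ.∣ n → Σ ℕ λ h → n ≡ suc (2 * h)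
odd⇒suc-double zero 2∤0 = ⊥-elim (2∤0 (2 ∣0))
odd⇒suc-double (suc zero) _ = 0 , refl
odd⇒suc-double (suc (suc n)) 2∤n+2 =
  let h , n≡2h+1 = odd⇒suc-double n (λ 2∣n → 2∤n+2 (∣m∣n⇒∣m+n ∣-refl 2∣n))
  in suc h , trans (cong (λ m → suc (suc m)) n≡2h+1) (cong suc (sym (ℕ.*-suc 2 h)))

⇔-under : ∀ {A B C : Set} → (A → C) → (B → C) → (C → A ⇔ B) → A ⇔ B
⇔-under A→C B→C C→A⇔B = mk⇔ (λ a → Equivalence.to (C→A⇔B (A→C a)) a) (λ b → Equivalence.from (C→A⇔B (B→C b)) b)

Pi⇒Admissible : ∀ j {x p} → Pi j x p → Admissible x p
Pi⇒Admissible zero = proj₁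
Pi⇒Admissible (suc zero) = proj₁
Pi⇒Admissible (suc (suc j)) = proj₁

Pi-C⇒Admissible : ∀ n j q p → Pi j (C (suc n) q) p → Admissible q p
Pi-C⇒Admissible n j q p Π =
  let p-prime , p-odd , p∤↧C = Pi⇒Admissible j Π
  in p-prime , p-odd , Reduction.p∤↧C⇒p∤↧ p p-prime q n p∤↧C

Pi-neg⇒Admissible : ∀ j q p → Pi j (- q) p → Admissible q p
Pi-neg⇒Admissible j q p Π =
  let p-prime , p-odd , p∤↧-q = Pi⇒Admissible j Π
  in p-prime , p-odd , λ p∣↧q → p∤↧-q (subst (p ℕ.∣_) (sym (ℤ.+-injective (ℚ.↧-neg q))) p∣↧q)

module Reduced (q : ℚ) (p : ℕ) (adm : Admissible q p) where

  private
    p-prime = proj₁ adm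
    p-odd = proj₁ (proj₂ adm)

  open Reduction p p-prime public using (_≈ₚ_; ≈ₚ-C; ≈ₚ-neg)
  open Residues p p-prime public
  open Odd {proj₁ (odd⇒suc-double p p-odd)} (proj₂ (odd⇒suc-double p p-odd)) public

  t : ℤ
  t = proj₁ (Reduction.≈ₚ-exists p p-prime q (proj₂ (proj₂ adm)))

  q≈t : q ≈ₚ t
  q≈t = proj₂ (Reduction.≈ₚ-exists p p-prime q (proj₂ (proj₂ adm)))

  Pi⇔ : ∀ {x z} → x ≈ₚ z → ∀ j → Pi j x p ⇔ Πℤ j z
  Pi⇔ = Reduction.Pi⇔Πℤ p p-prime p-odd

Pi-C₂-zero : ∀ q p → Pi 0 (C 2 q) p ⇔ (Pi 0 q p ⊎ Pi 1 q p)
Pi-C₂-zero q p = ⇔-under (Pi-C⇒Admissible 1 0 q p) [ proj₁ , proj₁ ]′ λ adm →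
  let open Reduced q p adm in begin
  Pi 0 (C 2 q) p         ≈⟨ Pi⇔ (≈ₚ-C q≈t 2) 0 ⟩
  Πℤ 0 (Cℤ 2 t)          ≈⟨ Πℤ₀-C₂ t ⟩
  (Πℤ 0 t ⊎ Πℤ 1 t)      ≈⟨ Pi⇔ q≈t 0 ⊎-⇔ Pi⇔ q≈t 1 ⟨
  (Pi 0 q p ⊎ Pi 1 q p)  ∎

Pi-C₂-suc : ∀ q k → k ≥ 1 → ∀ p → Pi k (C 2 q) p ⇔ Pi (suc k) q p
Pi-C₂-suc q zero ()
Pi-C₂-suc q (suc k) _ p = ⇔-under (Pi-C⇒Admissible 1 (suc k) q p) (Pi⇒Admissible (2 ℕ.+ k)) λ adm →
  let open Reduced q p adm in begin
  Pi (suc k) (C 2 q) p   ≈⟨ Pi⇔ (≈ₚ-C q≈t 2) (suc k) ⟩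
  Πℤ (suc k) (Cℤ 2 t)    ≈⟨ Πℤ-suc-C₂ k t ⟩
  Πℤ (2 ℕ.+ k) t         ≈⟨ Pi⇔ q≈t (2 ℕ.+ k) ⟨
  Pi (2 ℕ.+ k) q p       ∎

Pi-C-odd : ∀ q m j p → Pi j (C (suc (2 * m)) q) p ⇔ Pi j q p
Pi-C-odd q m j p = ⇔-under (Pi-C⇒Admissible (2 * m) j q p) (Pi⇒Admissible j) λ adm →
  let open Reduced q p adm in begin
  Pi j (C (suc (2 * m)) q) p   ≈⟨ Pi⇔ (≈ₚ-C q≈t (suc (2 * m))) j ⟩
  Πℤ j (Cℤ (suc (2 * m)) t)    ≈⟨ Πℤ-Codd m j t ⟩
  Πℤ j t                       ≈⟨ Pi⇔ q≈t j ⟨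
  Pi j q p                     ∎

Pi-neg-zero : ∀ q p → Pi 0 (- q) p ⇔ Pi 1 q p
Pi-neg-zero q p = ⇔-under (Pi-neg⇒Admissible 0 q p) (Pi⇒Admissible 1) λ adm →
  let open Reduced q p adm in begin
  Pi 0 (- q) p     ≈⟨ Pi⇔ (≈ₚ-neg q≈t) 0 ⟩
  Πℤ 0 (-ℤ t)      ≈⟨ Πℤ₀-neg t ⟩
  Πℤ 1 t           ≈⟨ Pi⇔ q≈t 1 ⟨
  Pi 1 q p         ∎

Pi-neg-one : ∀ q p → Pi 1 (- q) p ⇔ Pi 0 q p
Pi-neg-one q p = ⇔-under (Pi-neg⇒Admissible 1 q p) (Pi⇒Admissible 0) λ adm →
  let open Reduced q p adm in begin
  Pi 1 (- q) p     ≈⟨ Pi⇔ (≈ₚ-neg q≈t) 1 ⟩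
  Πℤ 1 (-ℤ t)      ≈⟨ Πℤ₁-neg t ⟩
  Πℤ 0 t           ≈⟨ Pi⇔ q≈t 0 ⟨
  Pi 0 q p         ∎

Pi-neg-≥2 : ∀ q j → j ≥ 2 → ∀ p → Pi j (- q) p ⇔ Pi j q p
Pi-neg-≥2 q (suc zero) (ℕ.s≤s ())
Pi-neg-≥2 q (suc (suc j)) _ p = ⇔-under (Pi-neg⇒Admissible (2 ℕ.+ j) q p) (Pi⇒Admissible (2 ℕ.+ j)) λ adm →
  let open Reduced q p adm in begin
  Pi (2 ℕ.+ j) (- q) p    ≈⟨ Pi⇔ (≈ₚ-neg q≈t) (2 ℕ.+ j) ⟩
  Πℤ (2 ℕ.+ j) (-ℤ t)     ≈⟨ Πℤ-≥2-neg j t ⟩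
  Πℤ (2 ℕ.+ j) t          ≈⟨ Pi⇔ q≈t (2 ℕ.+ j) ⟨
  Pi (2 ℕ.+ j) q p        ∎

theorem2 : (q : ℚ) →
    (((p : ℕ) → Pi 0 (C 2 q) p ⇔ (Pi 0 q p ⊎ Pi 1 q p))
      × ((k : ℕ) → k ≥ 1 → (p : ℕ) → Pi k (C 2 q) p ⇔ Pi (suc k) q p))
    × ((m : ℕ) → (j : ℕ) → (p : ℕ) → Pi j (C (suc (2 * m)) q) p ⇔ Pi j q p)
    × (((p : ℕ) → Pi 0 (- q) p ⇔ Pi 1 q p)
      × ((p : ℕ) → Pi 1 (- q) p ⇔ Pi 0 q p)
      × ((j : ℕ) → j ≥ 2 → (p : ℕ) → Pi j (- q) p ⇔ Pi j q p))
theorem2 q = (Pi-C₂-zero q , Pi-C₂-suc q) , Pi-C-odd q , (Pi-neg-zero q , Pi-neg-one q , Pi-neg-≥2 q)
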